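{- Let $k$ and $m$ be positive integers and let $P$ be a partial $k$-latin square of order $m$. Then for every integer $n\geq 2m$ there exists a $k$-latin square $L$ of order $n$ such that $P(i,j)\subseteq L(i,j)$ (as multisets) for all $i,j\in N(m)$.
   Context: For a positive integer $a$, $N(a)=\{1,2,\dots,a\}$. All set operations and relations are taken with multiplicity: $A\subseteq B$ for multisets means every symbol occurs in $A$ at most as many times as it occurs in $B$. A partial $k$-latin square of order $n$ is an $n\times n$ array $P$ whose cell $(i,j)$ contains a multiset $P(i,j)$ of cardinality at most $k$ with elements from $N(n)$ (possibly empty), such that each symbol occurs at most $k$ times in each row and at most $k$ times in each column (counting multiplicities). A $k$-latin square of order $n$ is a partial $k$-latin square of order $n$ in which every cell contains exactly $k$ symbols (so each symbol occurs exactly $k$ times in each row and in each column). -}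

module Defs where

open import Data.Nat using (ℕ; zero; suc; _+_; _≤_)
open import Data.Fin using (Fin; zero; suc)
open import Relation.Binary.PropositionalEquality using (_≡_)

∑ : {n : ℕ} → (Fin n → ℕ) → ℕ
∑ {zero}  f = 0
∑ {suc n} f = f zero + ∑ (λ i → f (suc i))

-- A finite multiset with elements from N(n) (represented as Fin n),
-- given by its multiplicity function.
Multiset : ℕ → Set
Multiset n = Fin n → ℕ

∣_∣ₘ : {n : ℕ} → Multiset n → ℕ
∣ A ∣ₘ = ∑ A

_⊆ₘ_ : {n : ℕ} → Multiset n → Multiset n → Set
A ⊆ₘ B = ∀ s → A s ≤ B s

-- An n×n array whose cells are multisets over N(n).
-- Rows, columns and symbols are all indexed by Fin n (i.e. N(n) shifted by one).
Array : ℕ → Set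
Array n = Fin n → Fin n → Multiset n

record IsPartialKLatin (k n : ℕ) (P : Array n) : Set where
  field
    cellBound : ∀ i j → ∣ P i j ∣ₘ ≤ k
    rowBound  : ∀ i s → ∑ (λ j → P i j s) ≤ k
    colBound  : ∀ j s → ∑ (λ i → P i j s) ≤ k

record IsKLatin (k n : ℕ) (L : Array n) : Set where
  field
    partial   : IsPartialKLatin k n L
    cellExact : ∀ i j → ∣ L i j ∣ₘ ≡ k

open import Data.Nat using (_*_)
open import Data.Nat.Properties using (≤-trans; m≤m+n)

half≤ : {m n : ℕ} → 2 * m ≤ n → m ≤ n
half≤ {m} p = ≤-trans (m≤m+n m (m + 0)) p

open import Data.Fin using (inject≤)

emb : {m n : ℕ} → m ≤ n → Fin m → Fin n
emb le i = inject≤ i le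

restrict : {m n : ℕ} → m ≤ n → Multiset n → Multiset m
restrict le A s = A (emb le s)

-- "P(i,j) ⊆ L(i,j) for all i,j ∈ N(m)", where P has order m ≤ n and L order n.
-- Since P(i,j) only contains symbols from N(m), inclusion amounts to comparing
-- multiplicities of symbols in N(m).
Embeds : {m n : ℕ} → m ≤ n → Array m → Array n → Set
Embeds le P L = ∀ i j → P i j ⊆ₘ restrict le (L (emb le i) (emb le j))

-- An array of order n is a box of multiplicities indexed by (row, column, symbol);
-- it is k-latin when every line of the box, in each of the three directions, sums
-- to k.  Writing n = m + b with b ≥ m, the square P is completed by three extensions,
-- each along one direction: new symbols fill the cells of P, new columns complete its
-- rows, new rows complete all columns.  Each extension distributes an R × C matrix of
-- deficits, with line sums at most b * k, over b new slices whose line sums are at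
-- most k; this is König's edge-colouring theorem for bipartite multigraphs.
module Submission where

open import Defs
open import Data.Nat using (ℕ; zero; suc; _+_; _*_; _∸_; _≤_; _<_; z≤n; s≤s; NonZero)
open import Data.Nat.Properties
open import Data.Nat.Induction using (<-wellFounded)
open import Induction.WellFounded using (Acc; acc)
open import Data.Bool using (Bool; true; false; _∧_; _∨_; not; if_then_else_)
import Data.Bool.Properties as Boolₚ
open import Data.Fin using (Fin; zero; suc; splitAt; _↑ˡ_; _↑ʳ_)
open import Data.Fin.Properties using (any?; splitAt-↑ˡ; splitAt-↑ʳ; toℕ-injective; toℕ-inject≤; toℕ-↑ˡ)
  renaming (_≟_ to _≟ᶠ_; suc-injective to fsuc-injective)
open import Data.Fin.Subset.Properties using (anySubset?)
open import Data.Vec using (lookup; tabulate)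
open import Data.Vec.Properties using (lookup∘tabulate)
open import Data.Sum using (_⊎_; inj₁; inj₂)
open import Data.Product using (∃; _×_; _,_)
open import Data.Empty using (⊥; ⊥-elim)
open import Function using (_∘_)
open import Relation.Binary.PropositionalEquality
open import Relation.Nullary using (Dec; yes; no; ¬_; does)
open import Relation.Nullary.Decidable using (dec-true; dec-false; _×-dec_; ¬?)
open import Algebra.Properties.CommutativeMonoid.Sum +-0-commutativeMonoid
  using (sum; ∑-distrib-+; ∑-comm; sum-cong-≗)

∑-cong : ∀ {n} {f g : Fin n → ℕ} → (∀ i → f i ≡ g i) → ∑ f ≡ ∑ g
∑-cong {zero}  e = refl
∑-cong {suc n} e = cong₂ _+_ (e zero) (∑-cong (e ∘ suc))

∑-mono : ∀ {n} {f g : Fin n → ℕ} → (∀ i → f i ≤ g i) → ∑ f ≤ ∑ g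
∑-mono {zero}  e = z≤n
∑-mono {suc n} e = +-mono-≤ (e zero) (∑-mono (e ∘ suc))

-- ∑ agrees with the library's monoid sum, so the library's lemmas on sums transfer.
∑≡sum : ∀ {n} (f : Fin n → ℕ) → ∑ f ≡ sum f
∑≡sum {zero}  f = refl
∑≡sum {suc n} f = cong (f zero +_) (∑≡sum (f ∘ suc))

∑-+ : ∀ {n} (f g : Fin n → ℕ) → ∑ (λ i → f i + g i) ≡ ∑ f + ∑ g
∑-+ f g = begin
  ∑ (λ i → f i + g i)    ≡⟨ ∑≡sum (λ i → f i + g i) ⟩
  sum (λ i → f i + g i)  ≡⟨ ∑-distrib-+ f g ⟩
  sum f + sum g          ≡⟨ cong₂ _+_ (∑≡sum f) (∑≡sum g) ⟨
  ∑ f + ∑ g              ∎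
  where open ≡-Reasoning

∑-swap : ∀ {m n} (A : Fin m → Fin n → ℕ) →
         ∑ (λ i → ∑ (λ j → A i j)) ≡ ∑ (λ j → ∑ (λ i → A i j))
∑-swap A = begin
  ∑ (λ i → ∑ (λ j → A i j))      ≡⟨ ∑≡sum (λ i → ∑ (A i)) ⟩
  sum (λ i → ∑ (λ j → A i j))    ≡⟨ sum-cong-≗ (λ i → ∑≡sum (A i)) ⟩
  sum (λ i → sum (λ j → A i j))  ≡⟨ ∑-comm A ⟩
  sum (λ j → sum (λ i → A i j))  ≡⟨ sum-cong-≗ (λ j → ∑≡sum (λ i → A i j)) ⟨
  sum (λ j → ∑ (λ i → A i j))    ≡⟨ ∑≡sum (λ j → ∑ (λ i → A i j)) ⟨
  ∑ (λ j → ∑ (λ i → A i j))      ∎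
  where open ≡-Reasoning

∑-const : ∀ {n} (c : ℕ) → ∑ {n} (λ _ → c) ≡ n * c
∑-const {zero}  c = refl
∑-const {suc n} c = cong (c +_) (∑-const {n} c)

∑-zero : ∀ {n} → ∑ {n} (λ _ → 0) ≡ 0
∑-zero {zero}  = refl
∑-zero {suc n} = ∑-zero {n}

∑-*ˡ : ∀ {n} (c : ℕ) (f : Fin n → ℕ) → ∑ (λ i → c * f i) ≡ c * ∑ f
∑-*ˡ {zero}  c f = sym (*-zeroʳ c)
∑-*ˡ {suc n} c f =
  trans (cong (c * f zero +_) (∑-*ˡ c (f ∘ suc))) (sym (*-distribˡ-+ c (f zero) _))

∑-∸ : ∀ {n} (f g : Fin n → ℕ) → (∀ i → g i ≤ f i) → ∑ (λ i → f i ∸ g i) ≡ ∑ f ∸ ∑ g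
∑-∸ f g g≤f = begin
  ∑ (λ i → f i ∸ g i)                ≡⟨ m+n∸n≡m _ (∑ g) ⟨
  ∑ (λ i → f i ∸ g i) + ∑ g ∸ ∑ g    ≡⟨ cong (_∸ ∑ g) (∑-+ (λ i → f i ∸ g i) g) ⟨
  ∑ (λ i → f i ∸ g i + g i) ∸ ∑ g    ≡⟨ cong (_∸ ∑ g) (∑-cong (λ i → m∸n+n≡m (g≤f i))) ⟩
  ∑ f ∸ ∑ g                          ∎
  where open ≡-Reasoning

∑-bound : ∀ {n} {f : Fin n → ℕ} {c : ℕ} → (∀ i → f i ≤ c) → ∑ f ≤ n * c
∑-bound {n} {f} {c} f≤c = ≤-trans (∑-mono f≤c) (≤-reflexive (∑-const {n} c))

∑-exact : ∀ {n} {f : Fin n → ℕ} {c : ℕ} → (∀ i → f i ≤ c) → ∑ f ≡ n * c → ∀ i → f i ≡ c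
∑-exact {suc n} {f} {c} f≤c total = pointwise
  where
  head≡ : f zero ≡ c
  head≡ = ≤-antisym (f≤c zero) (+-cancelʳ-≤ (n * c) c (f zero) (begin
    c + n * c            ≡⟨ total ⟨
    f zero + ∑ (f ∘ suc) ≤⟨ +-monoʳ-≤ (f zero) (∑-bound (f≤c ∘ suc)) ⟩
    f zero + n * c       ∎))
    where open ≤-Reasoning
  tail≡ : ∑ (f ∘ suc) ≡ n * c
  tail≡ = +-cancelˡ-≡ c _ _ (trans (cong (_+ ∑ (f ∘ suc)) (sym head≡)) total)
  pointwise : ∀ i → f i ≡ c
  pointwise zero    = head≡
  pointwise (suc i) = ∑-exact (f≤c ∘ suc) tail≡ i

∑-point : ∀ {n} (f : Fin n → ℕ) (i : Fin n) → f i ≤ ∑ f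
∑-point f zero    = m≤m+n _ _
∑-point f (suc i) = ≤-trans (∑-point (f ∘ suc) i) (m≤n+m _ (f zero))

∑-strict : ∀ {n} {f g : Fin n → ℕ} (i : Fin n) → (∀ j → f j ≤ g j) → f i < g i → ∑ f < ∑ g
∑-strict zero    f≤g fi<gi = +-mono-<-≤ fi<gi (∑-mono (f≤g ∘ suc))
∑-strict (suc i) f≤g fi<gi = +-mono-≤-< (f≤g zero) (∑-strict i (f≤g ∘ suc) fi<gi)

∑-split : ∀ m {b} (f : Fin (m + b) → ℕ) → ∑ f ≡ ∑ (λ i → f (i ↑ˡ b)) + ∑ (λ t → f (m ↑ʳ t))
∑-split zero    f = refl
∑-split (suc m) f = trans (cong (f zero +_) (∑-split m (f ∘ suc))) (sym (+-assoc (f zero) _ _))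

diag : ∀ {n} → (Fin n → ℕ) → Fin n → Fin n → ℕ
diag f i j = if does (i ≟ᶠ j) then f i else 0

∑-diag-row : ∀ {n} (f : Fin n → ℕ) (i : Fin n) → ∑ (diag f i) ≡ f i
∑-diag-row {suc n} f zero    = trans (cong (f zero +_) (∑-zero {n})) (+-identityʳ (f zero))
∑-diag-row f (suc i) = ∑-diag-row (f ∘ suc) i

∑-diag-col : ∀ {n} (f : Fin n → ℕ) (j : Fin n) → ∑ (λ i → diag f i j) ≡ f j
∑-diag-col {suc n} f zero    = trans (cong (f zero +_) (∑-zero {n})) (+-identityʳ (f zero))
∑-diag-col f (suc j) = ∑-diag-col (f ∘ suc) j

∧-intro : ∀ {a b} → a ≡ true → b ≡ true → a ∧ b ≡ true
∧-intro refl refl = refl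

∧-elimˡ : ∀ a {b} → a ∧ b ≡ true → a ≡ true
∧-elimˡ true _ = refl

∧-elimʳ : ∀ a {b} → a ∧ b ≡ true → b ≡ true
∧-elimʳ true b≡true = b≡true

∨-introˡ : ∀ {a} b → a ≡ true → a ∨ b ≡ true
∨-introˡ b refl = refl

∨-introʳ : ∀ a {b} → b ≡ true → a ∨ b ≡ true
∨-introʳ true  _ = refl
∨-introʳ false b≡true = b≡true

∨-elim : ∀ a {b} → a ∨ b ≡ true → a ≡ true ⊎ b ≡ true
∨-elim true  _ = inj₁ refl
∨-elim false b≡true = inj₂ b≡true

Sub : ℕ → Set
Sub n = Fin n → Bool

χ : Bool → ℕ
χ true  = 1
χ false = 0

card : ∀ {n} → Sub n → ℕ
card S = ∑ (λ i → χ (S i))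

_∪_ _∩_ : ∀ {n} → Sub n → Sub n → Sub n
(S ∪ T) i = S i ∨ T i
(S ∩ T) i = S i ∧ T i

single : ∀ {n} → Fin n → Sub n
single u i = does (u ≟ᶠ i)

_─_ : ∀ {n} → Sub n → Fin n → Sub n
(S ─ u) i = S i ∧ not (single u i)

card-cong : ∀ {n} {S T : Sub n} → (∀ i → S i ≡ T i) → card S ≡ card T
card-cong S≗T = ∑-cong (cong χ ∘ S≗T)

χ-mono : ∀ {a b} → (a ≡ true → b ≡ true) → χ a ≤ χ b
χ-mono {false} _   = z≤n
χ-mono {true}  a⇒b rewrite a⇒b refl = ≤-refl

card-mono : ∀ {n} {S T : Sub n} → (∀ i → S i ≡ true → T i ≡ true) → card S ≤ card T
card-mono S⊆T = ∑-mono (λ i → χ-mono (S⊆T i))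

card-∪∩ : ∀ {n} (S T : Sub n) → card (S ∪ T) + card (S ∩ T) ≡ card S + card T
card-∪∩ S T = begin
  card (S ∪ T) + card (S ∩ T)              ≡⟨ ∑-+ (λ i → χ ((S ∪ T) i)) (λ i → χ ((S ∩ T) i)) ⟨
  ∑ (λ i → χ (S i ∨ T i) + χ (S i ∧ T i))  ≡⟨ ∑-cong (λ i → χ-∪∩ (S i) (T i)) ⟩
  ∑ (λ i → χ (S i) + χ (T i))              ≡⟨ ∑-+ (λ i → χ (S i)) (λ i → χ (T i)) ⟩
  card S + card T                          ∎
  where
  open ≡-Reasoning
  χ-∪∩ : ∀ a b → χ (a ∨ b) + χ (a ∧ b) ≡ χ a + χ b
  χ-∪∩ true  true  = refl
  χ-∪∩ true  false = refl
  χ-∪∩ false true  = refl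
  χ-∪∩ false false = refl

card-single : ∀ {n} (u : Fin n) → card (single u) ≡ 1
card-single {suc n} zero = cong suc (∑-zero {n})
card-single (suc u)      = card-single u

card-─ : ∀ {n} (S : Sub n) (u : Fin n) → S u ≡ true → card (S ─ u) + 1 ≡ card S
card-─ S u u∈S = begin
  card (S ─ u) + 1                              ≡⟨ cong (card (S ─ u) +_) (card-single u) ⟨
  card (S ─ u) + card (single u)                ≡⟨ ∑-+ (λ i → χ ((S ─ u) i)) (λ i → χ (single u i)) ⟨
  ∑ (λ i → χ ((S ─ u) i) + χ (single u i))      ≡⟨ ∑-cong pointwise ⟩
  card S                                        ∎
  where
  open ≡-Reasoning
  pointwise : ∀ i → χ ((S ─ u) i) + χ (single u i) ≡ χ (S i)
  pointwise i with u ≟ᶠ i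
  ... | yes refl rewrite u∈S = refl
  ... | no _     rewrite Boolₚ.∧-identityʳ (S i) = +-identityʳ (χ (S i))

single-elim : ∀ {n} {u i : Fin n} → single u i ≡ true → u ≡ i
single-elim {u = u} {i} u∈single with u ≟ᶠ i | u∈single
... | yes u≡i | _ = u≡i

─-elim : ∀ {n} (S : Sub n) (u i : Fin n) → (S ─ u) i ≡ true → S i ≡ true × u ≢ i
─-elim S u i i∈S─u = ∧-elimˡ (S i) i∈S─u , u≢i
  where
  u≢i : u ≢ i
  u≢i u≡i with trans (cong not (sym (dec-true (u ≟ᶠ i) u≡i))) (∧-elimʳ (S i) i∈S─u)
  ... | ()

card≤1 : ∀ {n} (S : Sub n) → (∀ i j → S i ≡ true → S j ≡ true → i ≡ j) → card S ≤ 1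
card≤1 {zero}  S unique = z≤n
card≤1 {suc n} S unique with S zero in S0
... | false = card≤1 (S ∘ suc) (λ i j Si Sj → fsuc-injective (unique (suc i) (suc j) Si Sj))
... | true  = s≤s (≤-reflexive (trans (∑-cong rest-empty) (∑-zero {n})))
  where
  rest-empty : ∀ i → χ (S (suc i)) ≡ 0
  rest-empty i with S (suc i) in Si
  ... | false = refl
  ... | true with unique zero (suc i) S0 Si
  ...   | ()

anyᵇ : ∀ {n} → (Fin n → Bool) → Bool
anyᵇ {zero}  f = false
anyᵇ {suc n} f = f zero ∨ anyᵇ (f ∘ suc)

anyᵇ-cong : ∀ {n} {f g : Fin n → Bool} → (∀ i → f i ≡ g i) → anyᵇ f ≡ anyᵇ g
anyᵇ-cong {zero}  f≗g = refl
anyᵇ-cong {suc n} f≗g = cong₂ _∨_ (f≗g zero) (anyᵇ-cong (f≗g ∘ suc))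

anyᵇ-intro : ∀ {n} (f : Fin n → Bool) i → f i ≡ true → anyᵇ f ≡ true
anyᵇ-intro f zero    fi = ∨-introˡ (anyᵇ (f ∘ suc)) fi
anyᵇ-intro f (suc i) fi = ∨-introʳ (f zero) (anyᵇ-intro (f ∘ suc) i fi)

anyᵇ-elim : ∀ {n} (f : Fin n → Bool) → anyᵇ f ≡ true → ∃ λ i → f i ≡ true
anyᵇ-elim {suc n} f any-f with ∨-elim (f zero) any-f
... | inj₁ f0 = zero , f0
... | inj₂ rest with anyᵇ-elim (f ∘ suc) rest
...   | i , fi = suc i , fi

anyᵇ-false : ∀ {n} (f : Fin n → Bool) → anyᵇ f ≡ false → ∀ i → f i ≡ false
anyᵇ-false f none i with f i in fi
... | false = refl
... | true with trans (sym (anyᵇ-intro f i fi)) none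
...   | ()

Graph : ℕ → ℕ → Set
Graph N M = Fin N → Fin M → Bool

Nbr : ∀ {N M} → Graph N M → Sub N → Sub M
Nbr G S j = anyᵇ (λ i → S i ∧ G i j)

Nbr-intro : ∀ {N M} (G : Graph N M) S i j → S i ≡ true → G i j ≡ true → Nbr G S j ≡ true
Nbr-intro G S i j i∈S Gij = anyᵇ-intro _ i (∧-intro i∈S Gij)

Nbr-elim : ∀ {N M} (G : Graph N M) S j → Nbr G S j ≡ true → ∃ λ i → S i ≡ true × G i j ≡ true
Nbr-elim G S j j∈N with anyᵇ-elim _ j∈N
... | i , p = i , ∧-elimˡ (S i) p , ∧-elimʳ (S i) p

Hall : ∀ {N M} → Graph N M → Set
Hall G = ∀ S → card S ≤ card (Nbr G S)

hall? : ∀ {N M} (G : Graph N M) → Hall G ⊎ (∃ λ S → card (Nbr G S) < card S)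
hall? G with anySubset? (λ T → card (Nbr G (lookup T)) <? card (lookup T))
... | yes (T , violated) = inj₂ (lookup T , violated)
... | no none = inj₁ λ S → ≮⇒≥ λ violated →
  none (tabulate S , subst₂ _<_ (card-cong (λ j → anyᵇ-cong (λ i → cong (_∧ G i j) (tab S i))))
                                (card-cong (tab S)) violated)
  where
  tab : ∀ {N} (S : Sub N) i → S i ≡ lookup (tabulate S) i
  tab S i = sym (lookup∘tabulate S i)

record Matching {N M} (G : Graph N M) : Set where
  field
    edge      : Graph N M
    edge⊆G    : ∀ i j → edge i j ≡ true → G i j ≡ true
    leftDeg   : ∀ i → card (edge i) ≡ 1
    rightDeg  : ∀ j → card (λ i → edge i j) ≤ 1

Branching : ∀ {N M} → Graph N M → Set
Branching G = ∃ λ u → ∃ λ v₁ → ∃ λ v₂ → v₁ ≢ v₂ × G u v₁ ≡ true × G u v₂ ≡ true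

branching? : ∀ {N M} (G : Graph N M) → Dec (Branching G)
branching? G = any? λ u → any? λ v₁ → any? λ v₂ →
  ¬? (v₁ ≟ᶠ v₂) ×-dec (G u v₁ Boolₚ.≟ true) ×-dec (G u v₂ Boolₚ.≟ true)

-- Without branching, a graph satisfying Hall's condition is itself a matching:
-- Hall applied to {i} gives i a neighbour, and applied to the left neighbours of j
-- it shows that j has at most one of them.
matching-unbranched : ∀ {N M} (G : Graph N M) → Hall G → ¬ Branching G → Matching G
matching-unbranched G hall unbranched = record
  { edge = G ; edge⊆G = λ _ _ Gij → Gij ; leftDeg = leftDeg ; rightDeg = rightDeg }
  where
  sameNbr : ∀ u v₁ v₂ → G u v₁ ≡ true → G u v₂ ≡ true → v₁ ≡ v₂
  sameNbr u v₁ v₂ e₁ e₂ with v₁ ≟ᶠ v₂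
  ... | yes v₁≡v₂ = v₁≡v₂
  ... | no v₁≢v₂  = ⊥-elim (unbranched (u , v₁ , v₂ , v₁≢v₂ , e₁ , e₂))
  leftDeg : ∀ i → card (G i) ≡ 1
  leftDeg i = ≤-antisym (card≤1 (G i) (sameNbr i)) (begin
    1                          ≡⟨ card-single i ⟨
    card (single i)            ≤⟨ hall (single i) ⟩
    card (Nbr G (single i))    ≤⟨ card-mono nbr⊆ ⟩
    card (G i)                 ∎)
    where
    open ≤-Reasoning
    nbr⊆ : ∀ j → Nbr G (single i) j ≡ true → G i j ≡ true
    nbr⊆ j j∈N with Nbr-elim G (single i) j j∈N
    ... | i′ , i′∈single , Gi′j = subst (λ x → G x j ≡ true) (sym (single-elim i′∈single)) Gi′j
  rightDeg : ∀ j → card (λ i → G i j) ≤ 1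
  rightDeg j = begin
    card (λ i → G i j)           ≤⟨ hall (λ i → G i j) ⟩
    card (Nbr G (λ i → G i j))   ≤⟨ card-mono nbr⊆ ⟩
    card (single j)              ≡⟨ card-single j ⟩
    1                            ∎
    where
    open ≤-Reasoning
    nbr⊆ : ∀ j′ → Nbr G (λ i → G i j) j′ ≡ true → single j j′ ≡ true
    nbr⊆ j′ j′∈N with Nbr-elim G (λ i → G i j) j′ j′∈N
    ... | i , Gij , Gij′ = dec-true (j ≟ᶠ j′) (sameNbr i j j′ Gij Gij′)

deleteEdge : ∀ {N M} → Graph N M → Fin N → Fin M → Graph N M
deleteEdge G u v i j = G i j ∧ not (single u i ∧ single v j)

deleteEdge-⊆ : ∀ {N M} (G : Graph N M) u v i j → deleteEdge G u v i j ≡ true → G i j ≡ true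
deleteEdge-⊆ G u v i j = ∧-elimˡ (G i j)

deleteEdge-keepsˡ : ∀ {N M} (G : Graph N M) u v i j → u ≢ i → deleteEdge G u v i j ≡ G i j
deleteEdge-keepsˡ G u v i j u≢i rewrite dec-false (u ≟ᶠ i) u≢i = Boolₚ.∧-identityʳ (G i j)

deleteEdge-keepsʳ : ∀ {N M} (G : Graph N M) u v i j → v ≢ j → deleteEdge G u v i j ≡ G i j
deleteEdge-keepsʳ G u v i j v≢j
  rewrite dec-false (v ≟ᶠ j) v≢j | Boolₚ.∧-zeroʳ (single u i) = Boolₚ.∧-identityʳ (G i j)

edgeCount : ∀ {N M} → Graph N M → ℕ
edgeCount G = ∑ (λ i → card (G i))

edgeCount-deleteEdge : ∀ {N M} (G : Graph N M) {u v} → G u v ≡ true →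
                       edgeCount (deleteEdge G u v) < edgeCount G
edgeCount-deleteEdge G {u} {v} Guv =
  ∑-strict u (λ i → card-mono (deleteEdge-⊆ G u v i))
    (∑-strict v (λ j → χ-mono (deleteEdge-⊆ G u v u j)) deleted<)
  where
  deleted : deleteEdge G u v u v ≡ false
  deleted rewrite dec-true (u ≟ᶠ u) refl | dec-true (v ≟ᶠ v) refl = Boolₚ.∧-zeroʳ (G u v)
  deleted< : χ (deleteEdge G u v u v) < χ (G u v)
  deleted< rewrite deleted | Guv = s≤s z≤n

-- If G satisfies Hall's condition and v₁ ≢ v₂, then deleting (u, v₁)
-- or deleting (u, v₂) preserves Hall's condition.  Suppose S₁, S₂ violate it after the
-- respective deletions.  Both contain u, and in G the neighbourhood of S₁ ∪ S₂ lies in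
-- N₁ ∪ N₂, that of (S₁ ∩ S₂) ─ u in N₁ ∩ N₂; Hall's condition for these two sets and
-- inclusion–exclusion then give |S₁| + |S₂| ≤ |N₁| + |N₂| + 1, contradicting |Nᵢ| < |Sᵢ|.
module Rado {N M} (G : Graph N M) (hall : Hall G) (u : Fin N) (v₁ v₂ : Fin M)
            (v₁≢v₂ : v₁ ≢ v₂) where

  violator-contains-u : ∀ v S → card (Nbr (deleteEdge G u v) S) < card S → S u ≡ true
  violator-contains-u v S violated with S u in u∈S
  ... | true  = refl
  ... | false = ⊥-elim (<⇒≱ violated (subst (card S ≤_) (card-cong sameNbr) (hall S)))
    where
    sameEdges : ∀ j i → (S i ∧ G i j) ≡ (S i ∧ deleteEdge G u v i j)
    sameEdges j i with u ≟ᶠ i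
    ... | yes refl rewrite u∈S = refl
    ... | no _     = cong (S i ∧_) (sym (Boolₚ.∧-identityʳ (G i j)))
    sameNbr : ∀ j → Nbr G S j ≡ Nbr (deleteEdge G u v) S j
    sameNbr j = anyᵇ-cong (sameEdges j)

  not-both-violated : ∀ S₁ S₂ → card (Nbr (deleteEdge G u v₁) S₁) < card S₁ →
                      card (Nbr (deleteEdge G u v₂) S₂) < card S₂ → ⊥
  not-both-violated S₁ S₂ bad₁ bad₂ = 1+n≰n (≤-trans (+-mono-≤ bad₁ bad₂) counting)
    where
    G₁ = deleteEdge G u v₁
    G₂ = deleteEdge G u v₂
    N₁ = Nbr G₁ S₁
    N₂ = Nbr G₂ S₂
    u∈S₁ = violator-contains-u v₁ S₁ bad₁
    u∈S₂ = violator-contains-u v₂ S₂ bad₂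

    nbr-∪ : ∀ j → Nbr G (S₁ ∪ S₂) j ≡ true → (N₁ ∪ N₂) j ≡ true
    nbr-∪ j j∈N with Nbr-elim G (S₁ ∪ S₂) j j∈N
    ... | i , i∈S₁∪S₂ , Gij = viaEdge (u ≟ᶠ i)
      where
      viaEdge : Dec (u ≡ i) → (N₁ ∪ N₂) j ≡ true
      viaEdge (no u≢i) with ∨-elim (S₁ i) i∈S₁∪S₂
      ... | inj₁ i∈S₁ = ∨-introˡ (N₂ j) (Nbr-intro G₁ S₁ i j i∈S₁ (trans (deleteEdge-keepsˡ G u v₁ i j u≢i) Gij))
      ... | inj₂ i∈S₂ = ∨-introʳ (N₁ j) (Nbr-intro G₂ S₂ i j i∈S₂ (trans (deleteEdge-keepsˡ G u v₂ i j u≢i) Gij))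
      viaEdge (yes u≡i) = viaTarget (v₁ ≟ᶠ j)
        where
        Guj : G u j ≡ true
        Guj = subst (λ x → G x j ≡ true) (sym u≡i) Gij
        viaTarget : Dec (v₁ ≡ j) → (N₁ ∪ N₂) j ≡ true
        viaTarget (yes v₁≡j) = ∨-introʳ (N₁ j) (Nbr-intro G₂ S₂ u j u∈S₂
          (trans (deleteEdge-keepsʳ G u v₂ u j (λ v₂≡j → v₁≢v₂ (trans v₁≡j (sym v₂≡j)))) Guj))
        viaTarget (no v₁≢j) = ∨-introˡ (N₂ j) (Nbr-intro G₁ S₁ u j u∈S₁
          (trans (deleteEdge-keepsʳ G u v₁ u j v₁≢j) Guj))

    nbr-∩ : ∀ j → Nbr G ((S₁ ∩ S₂) ─ u) j ≡ true → (N₁ ∩ N₂) j ≡ true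
    nbr-∩ j j∈N with Nbr-elim G ((S₁ ∩ S₂) ─ u) j j∈N
    ... | i , i∈Z , Gij with ─-elim (S₁ ∩ S₂) u i i∈Z
    ...   | i∈S₁∩S₂ , u≢i =
      ∧-intro (Nbr-intro G₁ S₁ i j (∧-elimˡ (S₁ i) i∈S₁∩S₂) (trans (deleteEdge-keepsˡ G u v₁ i j u≢i) Gij))
              (Nbr-intro G₂ S₂ i j (∧-elimʳ (S₁ i) i∈S₁∩S₂) (trans (deleteEdge-keepsˡ G u v₂ i j u≢i) Gij))

    counting : card S₁ + card S₂ ≤ card N₁ + suc (card N₂)
    counting = begin
      card S₁ + card S₂                            ≡⟨ card-∪∩ S₁ S₂ ⟨
      card (S₁ ∪ S₂) + card (S₁ ∩ S₂)              ≡⟨ cong (card (S₁ ∪ S₂) +_) (card-─ (S₁ ∩ S₂) u (∧-intro u∈S₁ u∈S₂)) ⟨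
      card (S₁ ∪ S₂) + (card ((S₁ ∩ S₂) ─ u) + 1)  ≤⟨ +-mono-≤ (≤-trans (hall (S₁ ∪ S₂)) (card-mono nbr-∪))
                                                               (+-monoˡ-≤ 1 (≤-trans (hall _) (card-mono nbr-∩))) ⟩
      card (N₁ ∪ N₂) + (card (N₁ ∩ N₂) + 1)        ≡⟨ +-assoc (card (N₁ ∪ N₂)) _ 1 ⟨
      card (N₁ ∪ N₂) + card (N₁ ∩ N₂) + 1          ≡⟨ cong (_+ 1) (card-∪∩ N₁ N₂) ⟩
      card N₁ + card N₂ + 1                        ≡⟨ +-assoc (card N₁) (card N₂) 1 ⟩
      card N₁ + (card N₂ + 1)                      ≡⟨ cong (card N₁ +_) (+-comm (card N₂) 1) ⟩
      card N₁ + suc (card N₂)                      ∎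
      where open ≤-Reasoning

-- Hall's theorem, by induction on the number of edges: a branching vertex lets us
-- delete an edge while keeping Hall's condition (Rado's lemma); an unbranched graph
-- is already a matching.
hall-theorem : ∀ {N M} (G : Graph N M) → Hall G → Matching G
hall-theorem G = go G (<-wellFounded (edgeCount G))
  where
  from-subgraph : ∀ {N M} {G : Graph N M} u v → Matching (deleteEdge G u v) → Matching G
  from-subgraph {G = G} u v m = record
    { edge = edge ; edge⊆G = λ i j e → deleteEdge-⊆ G u v i j (edge⊆G i j e)
    ; leftDeg = leftDeg ; rightDeg = rightDeg }
    where open Matching m

  go : ∀ {N M} (G : Graph N M) → Acc _<_ (edgeCount G) → Hall G → Matching G
  go G (acc smaller) hall with branching? G
  ... | no unbranched = matching-unbranched G hall unbranched
  ... | yes (u , v₁ , v₂ , v₁≢v₂ , e₁ , e₂) with hall? (deleteEdge G u v₁) | hall? (deleteEdge G u v₂)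
  ...   | inj₁ hall₁ | _ =
    from-subgraph u v₁ (go (deleteEdge G u v₁) (smaller (edgeCount-deleteEdge G e₁)) hall₁)
  ...   | inj₂ _ | inj₁ hall₂ =
    from-subgraph u v₂ (go (deleteEdge G u v₂) (smaller (edgeCount-deleteEdge G e₂)) hall₂)
  ...   | inj₂ (S₁ , bad₁) | inj₂ (S₂ , bad₂) =
    ⊥-elim (Rado.not-both-violated G hall u v₁ v₂ v₁≢v₂ S₁ S₂ bad₁ bad₂)

∑-splitAt : ∀ m {b} (g : Fin m ⊎ Fin b → ℕ) →
            ∑ (λ x → g (splitAt m x)) ≡ ∑ (g ∘ inj₁) + ∑ (g ∘ inj₂)
∑-splitAt m {b} g = trans (∑-split m (λ x → g (splitAt m x)))
  (cong₂ _+_ (∑-cong (λ i → cong g (splitAt-↑ˡ m i b))) (∑-cong (λ t → cong g (splitAt-↑ʳ m b t))))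

∑-↑ˡ-≤ : ∀ m {b} (f : Fin (m + b) → ℕ) → ∑ (λ i → f (i ↑ˡ b)) ≤ ∑ f
∑-↑ˡ-≤ m f = ≤-trans (m≤m+n _ _) (≤-reflexive (sym (∑-split m f)))

Matrix : ℕ → ℕ → Set
Matrix r c = Fin r → Fin c → ℕ

rowSum : ∀ {r c} → Matrix r c → Fin r → ℕ
rowSum A i = ∑ (A i)

colSum : ∀ {r c} → Matrix r c → Fin c → ℕ
colSum A j = ∑ (λ i → A i j)

positive : ℕ → Bool
positive zero    = false
positive (suc _) = true

support : ∀ {r c} → Matrix r c → Graph r c
support A i j = positive (A i j)

-- In a matrix with all line sums d + 1, every set S of rows meets at least |S| columns:
-- the rows of S carry weight (d + 1)|S|, all of it inside the columns N(S), whose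
-- total weight is (d + 1)|N(S)|.
hall-regular : ∀ {r c} (A : Matrix r c) d → (∀ i → rowSum A i ≡ suc d) →
               (∀ j → colSum A j ≡ suc d) → Hall (support A)
hall-regular {r} A d rows cols S = *-cancelˡ-≤ (suc d) (begin
  suc d * card S                             ≡⟨ ∑-*ˡ (suc d) (λ i → χ (S i)) ⟨
  ∑ (λ i → suc d * χ (S i))                  ≡⟨ ∑-cong rowWeight ⟩
  ∑ (λ i → ∑ (λ j → χ (S i) * A i j))        ≡⟨ ∑-swap (λ i j → χ (S i) * A i j) ⟩
  ∑ (λ j → ∑ (λ i → χ (S i) * A i j))        ≤⟨ ∑-mono colWeight ⟩
  ∑ (λ j → suc d * χ (Nbr (support A) S j))  ≡⟨ ∑-*ˡ (suc d) (λ j → χ (Nbr (support A) S j)) ⟩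
  suc d * card (Nbr (support A) S)           ∎)
  where
  open ≤-Reasoning
  rowWeight : ∀ i → suc d * χ (S i) ≡ ∑ (λ j → χ (S i) * A i j)
  rowWeight i = begin-equality
    suc d * χ (S i)          ≡⟨ *-comm (suc d) (χ (S i)) ⟩
    χ (S i) * suc d          ≡⟨ cong (χ (S i) *_) (rows i) ⟨
    χ (S i) * ∑ (A i)        ≡⟨ ∑-*ˡ (χ (S i)) (A i) ⟨
    ∑ (λ j → χ (S i) * A i j) ∎
  χ*≤ : ∀ s a → χ s * a ≤ a
  χ*≤ false a = z≤n
  χ*≤ true  a = ≤-reflexive (+-identityʳ a)
  outside : ∀ s a → (s ∧ positive a) ≡ false → χ s * a ≡ 0
  outside false a    _ = refl
  outside true  zero _ = refl
  colWeight : ∀ j → ∑ (λ i → χ (S i) * A i j) ≤ suc d * χ (Nbr (support A) S j)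
  colWeight j with Nbr (support A) S j in j∈N
  ... | true  = begin
    ∑ (λ i → χ (S i) * A i j)  ≤⟨ ∑-mono (λ i → χ*≤ (S i) (A i j)) ⟩
    ∑ (λ i → A i j)            ≡⟨ cols j ⟩
    suc d                      ≡⟨ *-identityʳ (suc d) ⟨
    suc d * 1                  ∎
  ... | false = ≤-reflexive (begin-equality
    ∑ (λ i → χ (S i) * A i j)  ≡⟨ ∑-cong (λ i → outside (S i) (A i j) (anyᵇ-false _ j∈N i)) ⟩
    ∑ {r} (λ _ → 0)            ≡⟨ ∑-zero {r} ⟩
    0                          ≡⟨ *-zeroʳ (suc d) ⟨
    suc d * 0                  ∎)

record Factor {r c} (k : ℕ) (A : Matrix r c) : Set where
  field
    F       : Matrix r c
    F≤A     : ∀ i j → F i j ≤ A i j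
    rowSumF : ∀ i → rowSum F i ≡ k
    colSumF : ∀ j → colSum F j ≡ k

-- König: a matrix with all line sums d + 1 has a 1-factor (a permutation matrix below it),
-- namely the indicator of a matching of its support given by Hall's theorem.
perfect-factor : ∀ {r c} (A : Matrix r c) d → (∀ i → rowSum A i ≡ suc d) →
                 (∀ j → colSum A j ≡ suc d) → Factor 1 A
perfect-factor {r} {c} A d rows cols = record
  { F = F ; F≤A = F≤A ; rowSumF = leftDeg ; colSumF = ∑-exact rightDeg total }
  where
  open Matching (hall-theorem (support A) (hall-regular A d rows cols))
  F : Matrix r c
  F i j = χ (edge i j)
  F≤A : ∀ i j → F i j ≤ A i j
  F≤A i j with edge i j in e | A i j in a
  ... | false | _     = z≤n
  ... | true  | suc _ = s≤s z≤n
  ... | true  | zero  with trans (sym (edge⊆G i j e)) (cong positive a)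
  ...   | ()
  square : r ≡ c
  square = *-cancelʳ-≡ r c (suc d) (begin
    r * suc d                    ≡⟨ ∑-const {r} (suc d) ⟨
    ∑ {r} (λ _ → suc d)          ≡⟨ ∑-cong rows ⟨
    ∑ (λ i → ∑ (A i))            ≡⟨ ∑-swap A ⟩
    ∑ (λ j → ∑ (λ i → A i j))    ≡⟨ ∑-cong cols ⟩
    ∑ {c} (λ _ → suc d)          ≡⟨ ∑-const {c} (suc d) ⟩
    c * suc d                    ∎)
    where open ≡-Reasoning
  total : ∑ (λ j → colSum F j) ≡ c * 1
  total = begin
    ∑ (λ j → ∑ (λ i → F i j))    ≡⟨ ∑-swap F ⟨
    ∑ (λ i → ∑ (F i))            ≡⟨ ∑-cong leftDeg ⟩
    ∑ {r} (λ _ → 1)              ≡⟨ ∑-const {r} 1 ⟩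
    r * 1                        ≡⟨ cong (_* 1) square ⟩
    c * 1                        ∎
    where open ≡-Reasoning

-- A matrix with all line sums k + d has a k-factor: remove k successive 1-factors.
factor : ∀ k d {r c} (A : Matrix r c) → (∀ i → rowSum A i ≡ k + d) →
         (∀ j → colSum A j ≡ k + d) → Factor k A
factor zero    d {r} {c} A rows cols = record
  { F = λ _ _ → 0 ; F≤A = λ _ _ → z≤n ; rowSumF = λ _ → ∑-zero {c} ; colSumF = λ _ → ∑-zero {r} }
factor (suc k) d A rows cols = record
  { F       = λ i j → F₁ i j + F′ i j
  ; F≤A     = λ i j → ≤-trans (+-monoʳ-≤ (F₁ i j) (F′≤A i j)) (≤-reflexive (m+[n∸m]≡n (F₁≤A i j)))
  ; rowSumF = λ i → trans (∑-+ (F₁ i) (F′ i)) (cong₂ _+_ (rowSumF₁ i) (rowSumF′ i))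
  ; colSumF = λ j → trans (∑-+ (λ i → F₁ i j) (λ i → F′ i j)) (cong₂ _+_ (colSumF₁ j) (colSumF′ j))
  }
  where
  open Factor (perfect-factor A (k + d) rows cols)
    renaming (F to F₁; F≤A to F₁≤A; rowSumF to rowSumF₁; colSumF to colSumF₁)
  rest : Factor k (λ i j → A i j ∸ F₁ i j)
  rest = factor k d (λ i j → A i j ∸ F₁ i j)
    (λ i → trans (∑-∸ (A i) (F₁ i) (F₁≤A i)) (cong₂ _∸_ (rows i) (rowSumF₁ i)))
    (λ j → trans (∑-∸ (λ i → A i j) (λ i → F₁ i j) (λ i → F₁≤A i j)) (cong₂ _∸_ (cols j) (colSumF₁ j)))
  open Factor rest renaming (F to F′; F≤A to F′≤A; rowSumF to rowSumF′; colSumF to colSumF′)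

-- Padding a matrix D with line sums at most Q to a matrix with all line sums Q:
--   [ D                     diag (Q ∸ rowSum D) ]
--   [ diag (Q ∸ colSum D)   Dᵀ                  ]
module Padding (Q : ℕ) {r c} (D : Matrix r c)
               (rowD : ∀ i → rowSum D i ≤ Q) (colD : ∀ j → colSum D j ≤ Q) where

  rowDeficit : Fin r → ℕ
  rowDeficit i = Q ∸ rowSum D i

  colDeficit : Fin c → ℕ
  colDeficit j = Q ∸ colSum D j

  block : Fin r ⊎ Fin c → Fin c ⊎ Fin r → ℕ
  block (inj₁ i) (inj₁ j)  = D i j
  block (inj₁ i) (inj₂ i′) = diag rowDeficit i i′
  block (inj₂ j′) (inj₁ j) = diag colDeficit j′ j
  block (inj₂ j) (inj₂ i)  = D i j

  pad : Matrix (r + c) (c + r)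
  pad x y = block (splitAt r x) (splitAt c y)

  pad-D : ∀ i j → pad (i ↑ˡ c) (j ↑ˡ r) ≡ D i j
  pad-D i j rewrite splitAt-↑ˡ r i c | splitAt-↑ˡ c j r = refl

  pad-rowSum : ∀ x → rowSum pad x ≡ Q
  pad-rowSum x = trans (∑-splitAt c (block (splitAt r x))) (rows (splitAt r x))
    where
    rows : ∀ X → ∑ (block X ∘ inj₁) + ∑ (block X ∘ inj₂) ≡ Q
    rows (inj₁ i) = trans (cong (rowSum D i +_) (∑-diag-row rowDeficit i)) (m+[n∸m]≡n (rowD i))
    rows (inj₂ j) = trans (cong (_+ colSum D j) (∑-diag-row colDeficit j)) (m∸n+n≡m (colD j))

  pad-colSum : ∀ y → colSum pad y ≡ Q
  pad-colSum y = trans (∑-splitAt r (λ X → block X (splitAt c y))) (cols (splitAt c y))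
    where
    cols : ∀ Y → ∑ (λ i → block (inj₁ i) Y) + ∑ (λ j → block (inj₂ j) Y) ≡ Q
    cols (inj₁ j) = trans (cong (colSum D j +_) (∑-diag-col colDeficit j)) (m+[n∸m]≡n (colD j))
    cols (inj₂ i) = trans (cong (_+ rowSum D i) (∑-diag-col rowDeficit i)) (m∸n+n≡m (rowD i))

slack-↑ˡ : ∀ m {b} (M F : Fin (m + b) → ℕ) → (∀ x → F x ≤ M x) →
           ∑ (λ i → M (i ↑ˡ b) ∸ F (i ↑ˡ b)) ≤ ∑ M ∸ ∑ F
slack-↑ˡ m M F F≤M = ≤-trans (∑-↑ˡ-≤ m (λ x → M x ∸ F x)) (≤-reflexive (∑-∸ M F F≤M))

-- Y is the top-left block of a
-- k-factor of the padded matrix.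
record Peel (k q : ℕ) {r c} (D : Matrix r c) : Set where
  field
    Y      : Matrix r c
    Y≤D    : ∀ i j → Y i j ≤ D i j
    rowY   : ∀ i → rowSum Y i ≤ k
    colY   : ∀ j → colSum Y j ≤ k
    rowD∸Y : ∀ i → ∑ (λ j → D i j ∸ Y i j) ≤ q * k
    colD∸Y : ∀ j → ∑ (λ i → D i j ∸ Y i j) ≤ q * k

peel : ∀ k q {r c} (D : Matrix r c) → (∀ i → rowSum D i ≤ k + q * k) →
       (∀ j → colSum D j ≤ k + q * k) → Peel k q D
peel k q {r} {c} D rowD colD = record
  { Y = Y ; Y≤D = Y≤D ; rowY = rowY ; colY = colY ; rowD∸Y = rowD∸Y ; colD∸Y = colD∸Y }
  where
  open Padding (k + q * k) D rowD colD
  open Factor (factor k (q * k) pad pad-rowSum pad-colSum)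

  Y : Matrix r c
  Y i j = F (i ↑ˡ c) (j ↑ˡ r)

  Y≤D : ∀ i j → Y i j ≤ D i j
  Y≤D i j = subst (Y i j ≤_) (pad-D i j) (F≤A _ _)

  rowY : ∀ i → rowSum Y i ≤ k
  rowY i = ≤-trans (∑-↑ˡ-≤ c (F (i ↑ˡ c))) (≤-reflexive (rowSumF _))

  colY : ∀ j → colSum Y j ≤ k
  colY j = ≤-trans (∑-↑ˡ-≤ r (λ x → F x (j ↑ˡ r))) (≤-reflexive (colSumF _))

  rowD∸Y : ∀ i → ∑ (λ j → D i j ∸ Y i j) ≤ q * k
  rowD∸Y i = begin
    ∑ (λ j → D i j ∸ Y i j)                  ≡⟨ ∑-cong (λ j → cong (_∸ Y i j) (pad-D i j)) ⟨
    ∑ (λ j → pad x (j ↑ˡ r) ∸ F x (j ↑ˡ r))  ≤⟨ slack-↑ˡ c (pad x) (F x) (F≤A x) ⟩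
    ∑ (pad x) ∸ ∑ (F x)                      ≡⟨ cong₂ _∸_ (pad-rowSum x) (rowSumF x) ⟩
    k + q * k ∸ k                            ≡⟨ m+n∸m≡n k (q * k) ⟩
    q * k                                    ∎
    where
    open ≤-Reasoning
    x = i ↑ˡ c

  colD∸Y : ∀ j → ∑ (λ i → D i j ∸ Y i j) ≤ q * k
  colD∸Y j = begin
    ∑ (λ i → D i j ∸ Y i j)                  ≡⟨ ∑-cong (λ i → cong (_∸ Y i j) (pad-D i j)) ⟨
    ∑ (λ i → pad (i ↑ˡ c) y ∸ F (i ↑ˡ c) y)  ≤⟨ slack-↑ˡ r (λ x → pad x y) (λ x → F x y) (λ x → F≤A x y) ⟩
    colSum pad y ∸ colSum F y                ≡⟨ cong₂ _∸_ (pad-colSum y) (colSumF y) ⟩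
    k + q * k ∸ k                            ≡⟨ m+n∸m≡n k (q * k) ⟩
    q * k                                    ∎
    where
    open ≤-Reasoning
    y = j ↑ˡ r

record Decomposition (k q : ℕ) {r c} (D : Matrix r c) : Set where
  field
    layer        : Fin q → Matrix r c
    layersSum    : ∀ i j → ∑ (λ t → layer t i j) ≡ D i j
    layerRowSum  : ∀ t i → rowSum (layer t) i ≤ k
    layerColSum  : ∀ t j → colSum (layer t) j ≤ k

decompose : ∀ k q {r c} (D : Matrix r c) → (∀ i → rowSum D i ≤ q * k) →
            (∀ j → colSum D j ≤ q * k) → Decomposition k q D
decompose k zero D rowD colD = record
  { layer = λ () ; layersSum = λ i j → sym (n≤0⇒n≡0 (≤-trans (∑-point (D i) j) (rowD i)))
  ; layerRowSum = λ () ; layerColSum = λ () }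
decompose k (suc q) D rowD colD = record
  { layer       = λ { zero → Y ; (suc t) → layer t }
  ; layersSum   = λ i j → trans (cong (Y i j +_) (layersSum i j)) (m+[n∸m]≡n (Y≤D i j))
  ; layerRowSum = λ { zero → rowY ; (suc t) → layerRowSum t }
  ; layerColSum = λ { zero → colY ; (suc t) → layerColSum t }
  }
  where
  open Peel (peel k q D rowD colD)
  open Decomposition (decompose k q (λ i j → D i j ∸ Y i j) rowD∸Y colD∸Y)

-- A three-dimensional array of multiplicities.  An Array n is a Box n n n with
-- coordinates (row, column, symbol); permuting coordinates gives its conjugates.
Box : ℕ → ℕ → ℕ → Set
Box R C Z = Fin R → Fin C → Fin Z → ℕ

zSum : ∀ {R C Z} → Box R C Z → Fin R → Fin C → ℕ
zSum A x y = ∑ (A x y)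

ySum : ∀ {R C Z} → Box R C Z → Fin R → Fin Z → ℕ
ySum A x z = ∑ (λ y → A x y z)

xSum : ∀ {R C Z} → Box R C Z → Fin C → Fin Z → ℕ
xSum A y z = ∑ (λ x → A x y z)

∑-swap-const : ∀ {m c} (A : Fin m → Fin c → ℕ) {k} → (∀ i → ∑ (A i) ≡ k) →
               ∑ (λ j → ∑ (λ i → A i j)) ≡ m * k
∑-swap-const {m} A {k} rows = trans (sym (∑-swap A)) (trans (∑-cong rows) (∑-const {m} k))

deficit-bounded : ∀ {m} b k (f : Fin m → ℕ) → m ≤ b → ∑ (λ x → k ∸ f x) ≤ b * k
deficit-bounded {m} b k f m≤b = ≤-trans (∑-bound (λ x → m∸n≤m k (f x))) (*-monoˡ-≤ k m≤b)

deficit-exact : ∀ m {b} k (f : Fin (m + b) → ℕ) → (∀ y → f y ≤ k) → ∑ f ≡ m * k →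
                ∑ (λ y → k ∸ f y) ≡ b * k
deficit-exact m {b} k f f≤k total = begin
  ∑ (λ y → k ∸ f y)            ≡⟨ ∑-∸ (λ _ → k) f f≤k ⟩
  ∑ {m + b} (λ _ → k) ∸ ∑ f    ≡⟨ cong₂ _∸_ (∑-const {m + b} k) total ⟩
  (m + b) * k ∸ m * k          ≡⟨ cong (_∸ m * k) (*-distribʳ-+ k m b) ⟩
  m * k + b * k ∸ m * k        ≡⟨ m+n∸m≡n (m * k) (b * k) ⟩
  b * k                        ∎
  where open ≡-Reasoning

-- The
-- deficits k ∸ zSum form an R × C matrix with line sums at most b * k; its b layers
-- (König) are the new slices, whose x- and y-lines therefore sum to at most k, and
-- to exactly k when the corresponding deficit sums are exactly b * k.
module Extension (k b : ℕ) {R C Z} (A : Box R C Z) (zA : ∀ x y → zSum A x y ≤ k)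
                 (rowDeficit : ∀ x → ∑ (λ y → k ∸ zSum A x y) ≤ b * k)
                 (colDeficit : ∀ y → ∑ (λ x → k ∸ zSum A x y) ≤ b * k) where

  deficit : Matrix R C
  deficit x y = k ∸ zSum A x y

  open Decomposition (decompose k b deficit rowDeficit colDeficit)

  slice : Fin R → Fin C → Fin Z ⊎ Fin b → ℕ
  slice x y (inj₁ z) = A x y z
  slice x y (inj₂ t) = layer t x y

  B : Box R C (Z + b)
  B x y w = slice x y (splitAt Z w)

  B-old : ∀ x y z → B x y (z ↑ˡ b) ≡ A x y z
  B-old x y z rewrite splitAt-↑ˡ Z z b = refl

  zSum-B : ∀ x y → zSum B x y ≡ k
  zSum-B x y = begin
    ∑ (λ w → slice x y (splitAt Z w))  ≡⟨ ∑-splitAt Z (slice x y) ⟩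
    zSum A x y + ∑ (λ t → layer t x y) ≡⟨ cong (zSum A x y +_) (layersSum x y) ⟩
    zSum A x y + deficit x y           ≡⟨ m+[n∸m]≡n (zA x y) ⟩
    k                                  ∎
    where open ≡-Reasoning

  ySum-B≤ : (∀ x z → ySum A x z ≤ k) → ∀ x w → ySum B x w ≤ k
  ySum-B≤ yA x w = lines (splitAt Z w)
    where
    lines : ∀ W → ∑ (λ y → slice x y W) ≤ k
    lines (inj₁ z) = yA x z
    lines (inj₂ t) = layerRowSum t x

  xSum-B≤ : (∀ y z → xSum A y z ≤ k) → ∀ y w → xSum B y w ≤ k
  xSum-B≤ xA y w = lines (splitAt Z w)
    where
    lines : ∀ W → ∑ (λ x → slice x y W) ≤ k
    lines (inj₁ z) = xA y z
    lines (inj₂ t) = layerColSum t y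

  ySum-B≡ : (∀ x z → ySum A x z ≡ k) → (∀ x → ∑ (deficit x) ≡ b * k) → ∀ x w → ySum B x w ≡ k
  ySum-B≡ yA exact x w = lines (splitAt Z w)
    where
    lines : ∀ W → ∑ (λ y → slice x y W) ≡ k
    lines (inj₁ z) = yA x z
    lines (inj₂ t) = ∑-exact (λ t → layerRowSum t x)
      (trans (∑-swap (λ t y → layer t x y)) (trans (∑-cong (layersSum x)) (exact x))) t

  xSum-B≡ : (∀ y z → xSum A y z ≡ k) → (∀ y → ∑ (λ x → deficit x y) ≡ b * k) → ∀ y w → xSum B y w ≡ k
  xSum-B≡ xA exact y w = lines (splitAt Z w)
    where
    lines : ∀ W → ∑ (λ x → slice x y W) ≡ k
    lines (inj₁ z) = xA y z
    lines (inj₂ t) = ∑-exact (λ t → layerColSum t y)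
      (trans (∑-swap (λ t x → layer t x y)) (trans (∑-cong (λ x → layersSum x y)) (exact y))) t

module Completion (k m b : ℕ) (P : Array m) (partialP : IsPartialKLatin k m P) (m≤b : m ≤ b) where
  open IsPartialKLatin partialP

  n : ℕ
  n = m + b

  module E₁ = Extension k b P cellBound
    (λ x → deficit-bounded b k (zSum P x) m≤b) (λ y → deficit-bounded b k (λ x → zSum P x y) m≤b)

  L₁ : Box m m n
  L₁ = E₁.B

  L₁-cell : ∀ x y → zSum L₁ x y ≡ k
  L₁-cell = E₁.zSum-B

  A₂ : Box m n m
  A₂ x s y = L₁ x y s

  -- Row x of L₁ holds m * k symbols, so its symbol deficits total exactly b * k.
  rowDeficit₁ : ∀ x → ∑ (λ s → k ∸ ySum L₁ x s) ≡ b * k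
  rowDeficit₁ x = deficit-exact m k (ySum L₁ x) (E₁.ySum-B≤ rowBound x) (∑-swap-const (L₁ x) (L₁-cell x))

  module E₂ = Extension k b A₂ (E₁.ySum-B≤ rowBound) (≤-reflexive ∘ rowDeficit₁)
    (λ s → deficit-bounded b k (λ x → zSum A₂ x s) m≤b)

  L₂ : Box m n n
  L₂ x y s = E₂.B x s y

  L₂-row : ∀ x s → ySum L₂ x s ≡ k
  L₂-row = E₂.zSum-B

  L₂-cell : ∀ x y → zSum L₂ x y ≡ k
  L₂-cell = E₂.ySum-B≡ L₁-cell rowDeficit₁

  L₂-col : ∀ y s → xSum L₂ y s ≤ k
  L₂-col y s = E₂.xSum-B≤ (λ s z → E₁.xSum-B≤ colBound z s) s y

  A₃ : Box n n m
  A₃ y s x = L₂ x y s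

  -- Column y of L₂ holds m * k symbols, and symbol s occurs m * k times in L₂, so the
  -- column–symbol deficits total exactly b * k along both directions.
  colDeficit₂ : ∀ y → ∑ (λ s → k ∸ xSum L₂ y s) ≡ b * k
  colDeficit₂ y = deficit-exact m k (xSum L₂ y) (L₂-col y) (∑-swap-const (λ x → L₂ x y) (λ x → L₂-cell x y))

  symbolDeficit₂ : ∀ s → ∑ (λ y → k ∸ xSum L₂ y s) ≡ b * k
  symbolDeficit₂ s = deficit-exact m k (λ y → xSum L₂ y s) (λ y → L₂-col y s)
    (∑-swap-const (λ x y → L₂ x y s) (λ x → L₂-row x s))

  module E₃ = Extension k b A₃ L₂-col (≤-reflexive ∘ colDeficit₂) (≤-reflexive ∘ symbolDeficit₂)

  L : Array n
  L x y s = E₃.B y s x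

  isKLatin : IsKLatin k n L
  isKLatin = record
    { partial = record
      { cellBound = λ x y → ≤-reflexive (L-cell x y)
      ; rowBound  = λ x s → ≤-reflexive (L-row x s)
      ; colBound  = λ y s → ≤-reflexive (E₃.zSum-B y s) }
    ; cellExact = L-cell }
    where
    L-cell : ∀ x y → ∣ L x y ∣ₘ ≡ k
    L-cell x y = E₃.ySum-B≡ (λ y x → L₂-cell x y) colDeficit₂ y x
    L-row : ∀ x s → ∑ (λ y → L x y s) ≡ k
    L-row x s = E₃.xSum-B≡ (λ s x → L₂-row x s) symbolDeficit₂ s x

  L-extends-P : ∀ i j s → L (i ↑ˡ b) (j ↑ˡ b) (s ↑ˡ b) ≡ P i j s
  L-extends-P i j s = begin
    E₃.B (j ↑ˡ b) (s ↑ˡ b) (i ↑ˡ b) ≡⟨ E₃.B-old (j ↑ˡ b) (s ↑ˡ b) i ⟩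
    E₂.B i (s ↑ˡ b) (j ↑ˡ b)        ≡⟨ E₂.B-old i (s ↑ˡ b) j ⟩
    E₁.B i j (s ↑ˡ b)               ≡⟨ E₁.B-old i j s ⟩
    P i j s                         ∎
    where open ≡-Reasoning

completion : ∀ k m b (P : Array m) → IsPartialKLatin k m P → m ≤ b →
             ∀ n (m≤n : m ≤ n) → m + b ≡ n → ∃ λ (L : Array n) → IsKLatin k n L × Embeds m≤n P L
completion k m b P partialP m≤b .(m + b) m≤n refl =
  L , isKLatin , λ i j s → ≤-reflexive (sym (begin
    L (emb m≤n i) (emb m≤n j) (emb m≤n s) ≡⟨ cong₃ L (emb≡↑ˡ i) (emb≡↑ˡ j) (emb≡↑ˡ s) ⟩
    L (i ↑ˡ b) (j ↑ˡ b) (s ↑ˡ b)          ≡⟨ L-extends-P i j s ⟩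
    P i j s                               ∎))
  where
  open Completion k m b P partialP m≤b
  open ≡-Reasoning
  emb≡↑ˡ : ∀ i → emb m≤n i ≡ i ↑ˡ b
  emb≡↑ˡ i = toℕ-injective (trans (toℕ-inject≤ i m≤n) (sym (toℕ-↑ˡ i b)))
  cong₃ : ∀ {X Y Z W : Set} (f : X → Y → Z → W) {x x′ y y′ z z′} →
          x ≡ x′ → y ≡ y′ → z ≡ z′ → f x y z ≡ f x′ y′ z′
  cong₃ f refl refl refl = refl

-- The theorem: for 2m ≤ n, write n = m + (n ∸ m) with m ≤ n ∸ m.
mainTheorem1 : (k m : ℕ) → .{{_ : NonZero k}} → .{{_ : NonZero m}} →
    (P : Array m) → IsPartialKLatin k m P →
    (n : ℕ) → (le : 2 * m ≤ n) →
    ∃ λ (L : Array n) → IsKLatin k n L × Embeds (half≤ le) P L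
mainTheorem1 k m P partialP n le =
  completion k m (n ∸ m) P partialP m≤n∸m n (half≤ le) (m+[n∸m]≡n (half≤ {m} le))
  where
  m≤n∸m : m ≤ n ∸ m
  m≤n∸m = m+n≤o⇒m≤o∸n m (subst (_≤ n) (cong (m +_) (+-identityʳ m)) le)
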